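{- For every $n\ge 0$ let $G_n=G_n(x_{11},x_{12},x_2;y_{11},y_{12},y_2)$ be the polynomial defined in the context. Then, as formal power series in $q$, $$\sum_{n\geq 0}G_{n}(x_{11},x_{12},x_2;y_{11},y_{12},y_2)q^n=\frac{1+a_0q+a_1q^2-\sqrt{1+a_2q+a_3q^2+a_4q^3+a_5q^4}}{2q},$$ where $a_0=y_2-x_2$, $a_1=x_{12}y_{12}-x_{11}y_{11}$, $a_2=-2(x_2+y_2)$, $a_3=(x_2+y_2)^2-2(x_{11}y_{11}+x_{12}y_{12})$, $a_4=2(x_{11}y_{11}-x_{12}y_{12})(x_2-y_2)$, $a_5=(x_{11}y_{11}-x_{12}y_{12})^2$, and the square root is the formal power series with constant term $1$.
   Context: A plane tree is an unlabeled rooted tree in which the children of every vertex are linearly ordered from left to right; $\mathcal{P}_n$ denotes the set of plane trees with $n$ edges. A leaf is a vertex with no children; an interior vertex is a vertex with at least one child. A leaf without any siblings is a singleton leaf. A leaf with siblings is an elder leaf if it is the leftmost child of its parent, and a young leaf otherwise. An interior vertex is a young interior vertex if it is not the parent of a singleton leaf or of an elder leaf. For $T\in\mathcal P_n$ let $\mathrm{sleaf}(T),\mathrm{eleaf}(T),\mathrm{yleaf}(T)$ be the numbers of singleton, elder and young leaves, $\mathrm{sint}(T),\mathrm{eint}(T)$ the numbers of parents of singleton leaves and of parents of elder leaves, and $\mathrm{yint}(T)$ the number of young interior vertices. For $n\ge2$, $G_n(x_{11},x_{12},x_2;y_{11},y_{12},y_2)=\sum_{T\in\mathcal P_n}x_{11}^{\mathrm{sleaf}(T)}x_{12}^{\mathrm{eleaf}(T)}x_2^{\mathrm{yleaf}(T)}y_{11}^{\mathrm{sint}(T)}y_{12}^{\mathrm{eint}(T)}y_2^{\mathrm{yint}(T)}$,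 and by convention $G_0=y_2$ and $G_1=x_{12}y_{12}$. -}

module Defs where

open import Data.Nat as ℕ using (ℕ; zero; suc; _∸_)
open import Data.Integer as ℤ using (ℤ; 0ℤ; 1ℤ; +_)
open import Data.List using (List; []; _∷_; map; concatMap; upTo)
open import Data.Vec as Vec using (Vec; []; _∷_; zipWith; replicate)
open import Data.Vec.Properties using (≡-dec)
open import Data.Fin using (Fin)
open import Data.Bool using (if_then_else_)
open import Data.Product using (Σ; _×_)
open import Relation.Nullary using (does)
open import Relation.Binary.PropositionalEquality using (_≡_)

data PTree : Set where
  node : List PTree → PTree

mutual
  edges : PTree → ℕ
  edges (node cs) = edgesF cs

  edgesF : List PTree → ℕ
  edgesF []       = 0
  edgesF (c ∷ cs) = suc (edges c ℕ.+ edgesF cs)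

mutual
  countV : (List PTree → ℕ) → PTree → ℕ
  countV f (node cs) = f cs ℕ.+ countF f cs

  countF : (List PTree → ℕ) → List PTree → ℕ
  countF f []       = 0
  countF f (c ∷ cs) = countV f c ℕ.+ countF f cs

leavesIn : List PTree → ℕ
leavesIn []                  = 0
leavesIn (node [] ∷ cs)      = suc (leavesIn cs)
leavesIn (node (_ ∷ _) ∷ cs) = leavesIn cs

-- local contributions of a vertex whose children list is given
-- singleton leaves among the children (leaf without siblings)
sleafL : List PTree → ℕ
sleafL (node [] ∷ []) = 1
sleafL _              = 0

-- elder leaves among the children (leftmost child, a leaf, with siblings)
eleafL : List PTree → ℕ
eleafL (node [] ∷ _ ∷ _) = 1
eleafL _                 = 0

-- young leaves among the children (leaves that are not the leftmost child)
yleafL : List PTree → ℕ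
yleafL []       = 0
yleafL (_ ∷ cs) = leavesIn cs

sintL : List PTree → ℕ
sintL (node [] ∷ []) = 1
sintL _              = 0

eintL : List PTree → ℕ
eintL (node [] ∷ _ ∷ _) = 1
eintL _                 = 0

-- is the vertex a young interior vertex: interior (has a child) and
-- not the parent of a singleton leaf nor of an elder leaf
yintL : List PTree → ℕ
yintL []                = 0
yintL (node [] ∷ [])    = 0
yintL (node [] ∷ _ ∷ _) = 0
yintL (node (_ ∷ _) ∷ _) = 1

sleaf eleaf yleaf sint eint yint : PTree → ℕ
sleaf = countV sleafL
eleaf = countV eleafL
yleaf = countV yleafL
sint  = countV sintL
eint  = countV eintL
yint  = countV yintL

-- forestsF fuel n : all ordered forests with n edges in total, where a
-- forest t₁ … t_k has Σ (edges tᵢ + 1) edges (each tree hangs from a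
-- common parent).  Fuel ≥ n suffices.
forestsF : ℕ → ℕ → List (List PTree)
forestsF _ zero          = [] ∷ []
forestsF zero (suc n)    = []
forestsF (suc f) (suc n) =
  concatMap (λ k → concatMap (λ t → map (t ∷_) (forestsF f (n ∸ k)))
                             (map node (forestsF f k)))
            (upTo (suc n))

planeTrees : ℕ → List PTree
planeTrees n = map node (forestsF n n)

-- Polynomials in the six variables x11, x12, x2, y11, y12, y2 over ℤ,
-- represented by their coefficient functions on exponent vectors
-- (x11, x12, x2, y11, y12, y2) ↦ coefficient.

Mono : Set
Mono = Vec ℕ 6

Poly : Set
Poly = Mono → ℤ

Σℤ : List ℤ → ℤ
Σℤ []       = 0ℤ
Σℤ (z ∷ zs) = z ℤ.+ Σℤ zs

below : ∀ {k} → Vec ℕ k → List (Vec ℕ k)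
below []      = [] ∷ []
below (a ∷ α) = concatMap (λ i → map (i ∷_) (below α)) (upTo (suc a))

mono : Mono → Poly
mono α β = if does (≡-dec ℕ._≟_ β α) then 1ℤ else 0ℤ

0ₚ 1ₚ : Poly
0ₚ _ = 0ℤ
1ₚ   = mono (replicate 6 0)

_+ₚ_ _-ₚ_ _*ₚ_ : Poly → Poly → Poly
(p +ₚ r) α = p α ℤ.+ r α
(p -ₚ r) α = p α ℤ.- r α
(p *ₚ r) α = Σℤ (map (λ β → p β ℤ.* r (zipWith _∸_ α β)) (below α))

_·ₚ_ : ℤ → Poly → Poly
(c ·ₚ p) α = c ℤ.* p α

Σₚ : List Poly → Poly
Σₚ []       = 0ₚ
Σₚ (p ∷ ps) = p +ₚ Σₚ ps

x11 x12 x2 y11 y12 y2 : Poly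
x11 = mono (1 ∷ 0 ∷ 0 ∷ 0 ∷ 0 ∷ 0 ∷ [])
x12 = mono (0 ∷ 1 ∷ 0 ∷ 0 ∷ 0 ∷ 0 ∷ [])
x2  = mono (0 ∷ 0 ∷ 1 ∷ 0 ∷ 0 ∷ 0 ∷ [])
y11 = mono (0 ∷ 0 ∷ 0 ∷ 1 ∷ 0 ∷ 0 ∷ [])
y12 = mono (0 ∷ 0 ∷ 0 ∷ 0 ∷ 1 ∷ 0 ∷ [])
y2  = mono (0 ∷ 0 ∷ 0 ∷ 0 ∷ 0 ∷ 1 ∷ [])

weight : PTree → Poly
weight T = mono (sleaf T ∷ eleaf T ∷ yleaf T ∷ sint T ∷ eint T ∷ yint T ∷ [])

G : ℕ → Poly
G zero          = y2
G (suc zero)    = x12 *ₚ y12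
G (suc (suc n)) = Σₚ (map weight (planeTrees (suc (suc n))))

Ser : Set
Ser = ℕ → Poly

_≈ₛ_ : Ser → Ser → Set
f ≈ₛ g = ∀ n α → f n α ≡ g n α

_+ₛ_ _-ₛ_ _*ₛ_ : Ser → Ser → Ser
(f +ₛ g) n = f n +ₚ g n
(f -ₛ g) n = f n -ₚ g n
(f *ₛ g) n = Σₚ (map (λ k → f k *ₚ g (n ∸ k)) (upTo (suc n)))

C : Poly → Ser
C p zero    = p
C p (suc _) = 0ₚ

q : Ser
q (suc zero) = 1ₚ
q _          = 0ₚ

IsSqrt : Ser → Ser → Set
IsSqrt R P = (∀ α → R 0 α ≡ 1ₚ α) × (R *ₛ R) ≈ₛ P

Gser : Ser
Gser = G

a0 a1 a2 a3 a4 a5 : Poly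
a0 = y2 -ₚ x2
a1 = (x12 *ₚ y12) -ₚ (x11 *ₚ y11)
a2 = (ℤ.- (+ 2)) ·ₚ (x2 +ₚ y2)
a3 = ((x2 +ₚ y2) *ₚ (x2 +ₚ y2)) -ₚ ((+ 2) ·ₚ ((x11 *ₚ y11) +ₚ (x12 *ₚ y12)))
a4 = (+ 2) ·ₚ (((x11 *ₚ y11) -ₚ (x12 *ₚ y12)) *ₚ (x2 -ₚ y2))
a5 = ((x11 *ₚ y11) -ₚ (x12 *ₚ y12)) *ₚ ((x11 *ₚ y11) -ₚ (x12 *ₚ y12))

Num : Ser
Num = C 1ₚ +ₛ ((C a0 *ₛ q) +ₛ (C a1 *ₛ (q *ₛ q)))

Rad : Ser
Rad = C 1ₚ +ₛ ((C a2 *ₛ q) +ₛ ((C a3 *ₛ (q *ₛ q)) +ₛ ((C a4 *ₛ (q *ₛ (q *ₛ q)))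
        +ₛ (C a5 *ₛ (q *ₛ (q *ₛ (q *ₛ q)))))))

module Submission where

-- Decomposing a plane tree at the first child of its root, and a forest at its first tree, gives
-- functional equations for the weight series T of plane trees and U of the forests that follow a
-- first child (all of whose leaves are young):
--   T = 1 + q (x₁₁y₁₁ − x₁₂y₁₂ + W U),   W = x₁₂y₁₂ + y₂ (T − 1),
--   U = 1 + q V U,                       V = T + x₂ − 1.
-- With G = T + y₂ − 1 + q (x₁₂y₁₂ − x₁₁y₁₁), the series 1 + a₀q + a₁q² − 2qG then squares to
-- 1 + a₂q + a₃q² + a₄q³ + a₅q⁴, a polynomial identity modulo the two equations. Square roots with
-- constant term 1 are unique because doubling is injective on ℤ[x₁₁, …, y₂].

open import Level using (0ℓ)
open import Algebra.Bundles using (Semiring; CommutativeRing; RawRing)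
open import Algebra.Structures using (IsCommutativeRing)
open import Algebra.Solver.Ring.AlmostCommutativeRing
  using (fromCommutativeRing; _-Raw-AlmostCommutative⟶_)
open import Data.Nat as ℕ using (ℕ; zero; suc; _∸_; _≤_; _<_; z≤n; s≤s)
open import Data.Nat.Induction using (<-rec)
open import Data.Integer as ℤ using (ℤ; 0ℤ; 1ℤ; +_; -[1+_])
import Data.Integer.Properties as ℤ
open import Data.List using (List; []; _∷_; map; _++_; concatMap; applyUpTo)
import Data.List.Properties as List
open import Data.Product using (_,_)
open import Data.Vec using (Vec; []; _∷_; zipWith; replicate)
open import Function using (_∘_; id)
open import Relation.Binary.Core using (Rel)
open import Relation.Binary.PropositionalEquality as ≡ using (_≡_)

module Sums {c ℓ} (R : Semiring c ℓ) where
  open Semiring R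
  open import Relation.Binary.Reasoning.Setoid setoid

  ∑ : List Carrier → Carrier
  ∑ []       = 0#
  ∑ (x ∷ xs) = x + ∑ xs

  ∑-map-cong : ∀ {a} {A : Set a} {f g : A → Carrier} → (∀ x → f x ≈ g x) → ∀ xs → ∑ (map f xs) ≈ ∑ (map g xs)
  ∑-map-cong f≈g []       = refl
  ∑-map-cong f≈g (x ∷ xs) = +-cong (f≈g x) (∑-map-cong f≈g xs)

  ∑-applyUpTo-cong : {f g : ℕ → Carrier} → (∀ i → f i ≈ g i) → ∀ n → ∑ (applyUpTo f n) ≈ ∑ (applyUpTo g n)
  ∑-applyUpTo-cong f≈g zero    = refl
  ∑-applyUpTo-cong f≈g (suc n) = +-cong (f≈g 0) (∑-applyUpTo-cong (f≈g ∘ suc) n)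

  *-distribˡ-∑ : ∀ {a} {A : Set a} y (f : A → Carrier) xs → y * ∑ (map f xs) ≈ ∑ (map (λ x → y * f x) xs)
  *-distribˡ-∑ y f []       = zeroʳ y
  *-distribˡ-∑ y f (x ∷ xs) = trans (distribˡ y _ _) (+-congˡ (*-distribˡ-∑ y f xs))

  *-distribʳ-∑ : ∀ {a} {A : Set a} y (f : A → Carrier) xs → ∑ (map f xs) * y ≈ ∑ (map (λ x → f x * y) xs)
  *-distribʳ-∑ y f []       = zeroˡ y
  *-distribʳ-∑ y f (x ∷ xs) = trans (distribʳ y _ _) (+-congˡ (*-distribʳ-∑ y f xs))

  ∑-* : ∀ {a b} {A : Set a} {B : Set b} (f : A → Carrier) (g : B → Carrier) xs ys →
        ∑ (map f xs) * ∑ (map g ys) ≈ ∑ (map (λ x → ∑ (map (λ y → f x * g y) ys)) xs)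
  ∑-* f g xs ys = trans (*-distribʳ-∑ _ f xs) (∑-map-cong (λ x → *-distribˡ-∑ (f x) g ys) xs)

  ∑-++ : ∀ xs ys → ∑ (xs ++ ys) ≈ ∑ xs + ∑ ys
  ∑-++ []       ys = sym (+-identityˡ _)
  ∑-++ (x ∷ xs) ys = trans (+-congˡ (∑-++ xs ys)) (sym (+-assoc _ _ _))

  ∑-concatMap : ∀ {a b} {A : Set a} {B : Set b} (f : B → Carrier) (g : A → List B) xs →
                ∑ (map f (concatMap g xs)) ≈ ∑ (map (λ x → ∑ (map f (g x))) xs)
  ∑-concatMap f g []       = refl
  ∑-concatMap f g (x ∷ xs) = begin
    ∑ (map f (g x ++ concatMap g xs))                 ≡⟨ ≡.cong ∑ (List.map-++ f (g x) _) ⟩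
    ∑ (map f (g x) ++ map f (concatMap g xs))         ≈⟨ ∑-++ (map f (g x)) _ ⟩
    ∑ (map f (g x)) + ∑ (map f (concatMap g xs))      ≈⟨ +-congˡ (∑-concatMap f g xs) ⟩
    ∑ (map f (g x)) + ∑ (map (λ x → ∑ (map f (g x))) xs) ∎

module IntegerCoefficients {c ℓ} (R : CommutativeRing c ℓ) where
  open CommutativeRing R
  open import Relation.Binary.Reasoning.Setoid setoid
  open import Algebra.Properties.Ring ring using (-0#≈0#; -‿involutive; -‿+-comm; -‿distribˡ-*)
  open import Algebra.Properties.Semiring.Mult.TCOptimised semiring using (_×_; 1+×; ×-homo-+; ×1-homo-*)
  open import Algebra.Solver.Ring.NaturalCoefficients.Default commutativeSemiring
    using (solve; _:=_; _:+_; _:*_)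
  open import Data.Sign as Sign using (Sign)
  import Data.Nat.Properties as ℕ

  -- _×_ is the variant with 1 × x = x, so that fromℤ 1ℤ is 1# on the nose, as the ring solver requires
  fromℤ : ℤ → Carrier
  fromℤ (+ n)    = n × 1#
  fromℤ -[1+ n ] = - (suc n × 1#)

  fromSign : Sign → Carrier
  fromSign Sign.+ = 1#
  fromSign Sign.- = - 1#

  fromℤ-⊖ : ∀ m n → fromℤ (m ℤ.⊖ n) ≈ m × 1# - n × 1#
  fromℤ-⊖ zero    zero    = sym (-‿inverseʳ 0#)
  fromℤ-⊖ (suc m) zero    = sym (trans (+-congˡ -0#≈0#) (+-identityʳ _))
  fromℤ-⊖ zero    (suc n) = sym (+-identityˡ _)
  fromℤ-⊖ (suc m) (suc n) = begin
    fromℤ (suc m ℤ.⊖ suc n)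
      ≡⟨ ≡.cong fromℤ (ℤ.[1+m]⊖[1+n]≡m⊖n m n) ⟩
    fromℤ (m ℤ.⊖ n)
      ≈⟨ fromℤ-⊖ m n ⟩
    m × 1# - n × 1#
      ≈⟨ +-identityʳ _ ⟨
    (m × 1# - n × 1#) + 0#
      ≈⟨ +-congˡ (-‿inverseʳ 1#) ⟨
    (m × 1# - n × 1#) + (1# - 1#)
      ≈⟨ solve 4 (λ a b o o′ → (a :+ b) :+ (o :+ o′) := (o :+ a) :+ (o′ :+ b)) refl (m × 1#) (- (n × 1#)) 1# (- 1#) ⟩
    (1# + m × 1#) + (- 1# - n × 1#)
      ≈⟨ +-cong (1+× m 1#) (sym (-‿+-comm 1# (n × 1#))) ⟨
    suc m × 1# - (1# + n × 1#)
      ≈⟨ +-congˡ (-‿cong (1+× n 1#)) ⟨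
    suc m × 1# - suc n × 1# ∎

  fromℤ-+ : ∀ i j → fromℤ (i ℤ.+ j) ≈ fromℤ i + fromℤ j
  fromℤ-+ (+ m)    (+ n)    = ×-homo-+ 1# m n
  fromℤ-+ (+ m)    -[1+ n ] = fromℤ-⊖ m (suc n)
  fromℤ-+ -[1+ m ] (+ n)    = trans (fromℤ-⊖ n (suc m)) (+-comm _ _)
  fromℤ-+ -[1+ m ] -[1+ n ] = begin
    - (suc (suc (m ℕ.+ n)) × 1#)    ≡⟨ ≡.cong (λ k → - (suc k × 1#)) (ℕ.+-suc m n) ⟨
    - ((suc m ℕ.+ suc n) × 1#)      ≈⟨ -‿cong (×-homo-+ 1# (suc m) (suc n)) ⟩
    - (suc m × 1# + suc n × 1#)     ≈⟨ -‿+-comm _ _ ⟨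
    - (suc m × 1#) + - (suc n × 1#) ∎

  fromℤ-◃ : ∀ s n → fromℤ (s ℤ.◃ n) ≈ fromSign s * n × 1#
  fromℤ-◃ s      zero    = sym (zeroʳ _)
  fromℤ-◃ Sign.+ (suc n) = sym (*-identityˡ _)
  fromℤ-◃ Sign.- (suc n) = trans (-‿cong (sym (*-identityˡ _))) (-‿distribˡ-* 1# _)

  fromSign-* : ∀ s t → fromSign (s Sign.* t) ≈ fromSign s * fromSign t
  fromSign-* Sign.+ t      = sym (*-identityˡ _)
  fromSign-* Sign.- Sign.+ = sym (*-identityʳ _)
  fromSign-* Sign.- Sign.- = begin
    1#              ≈⟨ -‿involutive 1# ⟨
    - (- 1#)        ≈⟨ -‿cong (*-identityˡ (- 1#)) ⟨
    - (1# * - 1#)   ≈⟨ -‿distribˡ-* 1# (- 1#) ⟩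
    - 1# * - 1#     ∎

  fromℤ-signAbs : ∀ i → fromℤ i ≈ fromSign (ℤ.sign i) * ℤ.∣ i ∣ × 1#
  fromℤ-signAbs i = trans (reflexive (≡.cong fromℤ (≡.sym (ℤ.◃-inverse i)))) (fromℤ-◃ (ℤ.sign i) ℤ.∣ i ∣)

  fromℤ-* : ∀ i j → fromℤ (i ℤ.* j) ≈ fromℤ i * fromℤ j
  fromℤ-* i j = begin
    fromℤ (i ℤ.* j)
      ≈⟨ fromℤ-◃ (s Sign.* t) (m ℕ.* n) ⟩
    fromSign (s Sign.* t) * (m ℕ.* n) × 1#
      ≈⟨ *-cong (fromSign-* s t) (×1-homo-* m n) ⟩
    (fromSign s * fromSign t) * (m × 1# * n × 1#)
      ≈⟨ solve 4 (λ a b x y → (a :* b) :* (x :* y) := (a :* x) :* (b :* y))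
           refl (fromSign s) (fromSign t) (m × 1#) (n × 1#) ⟩
    (fromSign s * m × 1#) * (fromSign t * n × 1#)
      ≈⟨ *-cong (fromℤ-signAbs i) (fromℤ-signAbs j) ⟨
    fromℤ i * fromℤ j ∎
    where
    s = ℤ.sign i
    t = ℤ.sign j
    m = ℤ.∣ i ∣
    n = ℤ.∣ j ∣

  fromℤ-neg : ∀ i → fromℤ (ℤ.- i) ≈ - fromℤ i
  fromℤ-neg (+ zero)  = sym -0#≈0#
  fromℤ-neg (+ suc n) = refl
  fromℤ-neg -[1+ n ]  = sym (-‿involutive _)

  fromℤ-morphism : ℤ.+-*-rawRing -Raw-AlmostCommutative⟶ fromCommutativeRing R
  fromℤ-morphism = record
    { ⟦_⟧    = fromℤ
    ; +-homo = fromℤ-+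
    ; *-homo = fromℤ-*
    ; -‿homo = fromℤ-neg
    ; 0-homo = refl
    ; 1-homo = refl
    }

module PowerSeries {c ℓ} (R : CommutativeRing c ℓ) where
  open CommutativeRing R hiding (isCommutativeRing)
  open Sums semiring
  open import Relation.Binary.Reasoning.Setoid setoid
  open import Algebra.Solver.Ring.NaturalCoefficients.Default commutativeSemiring
    using (solve; _:=_; _:+_; _:*_; con)

  Series : Set c
  Series = ℕ → Carrier

  infix  4 _≋_
  infixl 6 _⊕_
  infixl 7 _⊛_ _•_
  infix  8 ⊝_

  _≋_ : Rel Series ℓ
  f ≋ g = ∀ n → f n ≈ g n

  -- applyUpTo rather than map over upTo, so that (f ⊛ g) (suc n) unfolds to f 0 * g (suc n) + (tail f ⊛ g) n
  _⊕_ _⊛_ : Series → Series → Series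
  (f ⊕ g) n = f n + g n
  (f ⊛ g) n = ∑ (applyUpTo (λ k → f k * g (n ∸ k)) (suc n))

  ⊝_ : Series → Series
  (⊝ f) n = - f n

  const : Carrier → Series
  const a zero    = a
  const a (suc _) = 0#

  𝟘 𝟙 : Series
  𝟘 _ = 0#
  𝟙   = const 1#

  _•_ : Carrier → Series → Series
  (a • f) n = a * f n

  tail : Series → Series
  tail f n = f (suc n)

  shift : Series → Series
  shift f zero    = 0#
  shift f (suc n) = f n

  ≋-refl : ∀ {f} → f ≋ f
  ≋-refl n = refl

  ≋-sym : ∀ {f g} → f ≋ g → g ≋ f
  ≋-sym f≋g n = sym (f≋g n)

  ≋-trans : ∀ {f g h} → f ≋ g → g ≋ h → f ≋ h
  ≋-trans f≋g g≋h n = trans (f≋g n) (g≋h n)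

  ⊛-cong-≤ : ∀ {f f′ g g′} n → (∀ {k} → k ≤ n → f k ≈ f′ k) → (∀ {k} → k ≤ n → g k ≈ g′ k) →
             (f ⊛ g) n ≈ (f′ ⊛ g′) n
  ⊛-cong-≤ zero    f≈ g≈ = +-cong (*-cong (f≈ z≤n) (g≈ z≤n)) refl
  ⊛-cong-≤ (suc n) f≈ g≈ =
    +-cong (*-cong (f≈ z≤n) (g≈ ≤-refl))
           (⊛-cong-≤ n (λ k≤n → f≈ (s≤s k≤n)) (λ k≤n → g≈ (m≤n⇒m≤1+n k≤n)))
    where open import Data.Nat.Properties using (≤-refl; m≤n⇒m≤1+n)

  ⊛-cong : ∀ {f f′ g g′} → f ≋ f′ → g ≋ g′ → f ⊛ g ≋ f′ ⊛ g′
  ⊛-cong f≋f′ g≋g′ n = ⊛-cong-≤ n (λ {k} _ → f≋f′ k) (λ {k} _ → g≋g′ k)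

  ⊛-zeroˡ : ∀ g → 𝟘 ⊛ g ≋ 𝟘
  ⊛-zeroˡ g zero    = trans (+-identityʳ _) (zeroˡ _)
  ⊛-zeroˡ g (suc n) = trans (+-cong (zeroˡ _) (⊛-zeroˡ g n)) (+-identityʳ _)

  ⊛-identityˡ : ∀ f → 𝟙 ⊛ f ≋ f
  ⊛-identityˡ f zero    = trans (+-identityʳ _) (*-identityˡ _)
  ⊛-identityˡ f (suc n) = trans (+-cong (*-identityˡ _) (⊛-zeroˡ f n)) (+-identityʳ _)

  •-⊛ : ∀ a f g → (a • f) ⊛ g ≋ a • (f ⊛ g)
  •-⊛ a f g zero    = solve 3 (λ a x y → (a :* x) :* y :+ con 0 := a :* (x :* y :+ con 0)) refl a (f 0) (g 0)
  •-⊛ a f g (suc n) = begin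
    (a * f 0) * g (suc n) + ((a • tail f) ⊛ g) n
      ≈⟨ +-congˡ (•-⊛ a (tail f) g n) ⟩
    (a * f 0) * g (suc n) + a * (tail f ⊛ g) n
      ≈⟨ solve 4 (λ a x y z → (a :* x) :* y :+ a :* z := a :* (x :* y :+ z)) refl a (f 0) (g (suc n)) _ ⟩
    a * (f 0 * g (suc n) + (tail f ⊛ g) n) ∎

  ⊛-distribˡ : ∀ f g h → f ⊛ (g ⊕ h) ≋ f ⊛ g ⊕ f ⊛ h
  ⊛-distribˡ f g h zero    =
    solve 3 (λ x y z → x :* (y :+ z) :+ con 0 := (x :* y :+ con 0) :+ (x :* z :+ con 0))
      refl (f 0) (g 0) (h 0)
  ⊛-distribˡ f g h (suc n) = begin
    f 0 * (g (suc n) + h (suc n)) + (tail f ⊛ (g ⊕ h)) n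
      ≈⟨ +-congˡ (⊛-distribˡ (tail f) g h n) ⟩
    f 0 * (g (suc n) + h (suc n)) + ((tail f ⊛ g) n + (tail f ⊛ h) n)
      ≈⟨ solve 5 (λ x y z u v → x :* (y :+ z) :+ (u :+ v) := (x :* y :+ u) :+ (x :* z :+ v))
           refl (f 0) (g (suc n)) (h (suc n)) _ _ ⟩
    (f 0 * g (suc n) + (tail f ⊛ g) n) + (f 0 * h (suc n) + (tail f ⊛ h) n) ∎

  ⊛-distribʳ : ∀ h f g → (f ⊕ g) ⊛ h ≋ f ⊛ h ⊕ g ⊛ h
  ⊛-distribʳ h f g zero    =
    solve 3 (λ x y z → (y :+ z) :* x :+ con 0 := (y :* x :+ con 0) :+ (z :* x :+ con 0))
      refl (h 0) (f 0) (g 0)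
  ⊛-distribʳ h f g (suc n) = begin
    (f 0 + g 0) * h (suc n) + ((tail f ⊕ tail g) ⊛ h) n
      ≈⟨ +-congˡ (⊛-distribʳ h (tail f) (tail g) n) ⟩
    (f 0 + g 0) * h (suc n) + ((tail f ⊛ h) n + (tail g ⊛ h) n)
      ≈⟨ solve 5 (λ x y z u v → (y :+ z) :* x :+ (u :+ v) := (y :* x :+ u) :+ (z :* x :+ v))
           refl (h (suc n)) (f 0) (g 0) _ _ ⟩
    (f 0 * h (suc n) + (tail f ⊛ h) n) + (g 0 * h (suc n) + (tail g ⊛ h) n) ∎

  ⊛-suc : ∀ f g n → (f ⊛ g) (suc n) ≈ (f ⊛ tail g) n + f (suc n) * g 0
  ⊛-suc f g zero    =
    solve 4 (λ a b c d → a :* b :+ (c :* d :+ con 0) := (a :* b :+ con 0) :+ c :* d)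
      refl (f 0) (g 1) (f 1) (g 0)
  ⊛-suc f g (suc n) = trans (+-congˡ (⊛-suc (tail f) g n)) (sym (+-assoc _ _ _))

  ⊛-comm : ∀ f g → f ⊛ g ≋ g ⊛ f
  ⊛-comm f g zero    = +-cong (*-comm _ _) refl
  ⊛-comm f g (suc n) = begin
    f 0 * g (suc n) + (tail f ⊛ g) n ≈⟨ +-congˡ (⊛-comm (tail f) g n) ⟩
    f 0 * g (suc n) + (g ⊛ tail f) n ≈⟨ solve 3 (λ a b y → a :* b :+ y := y :+ b :* a) refl (f 0) (g (suc n)) _ ⟩
    (g ⊛ tail f) n + g (suc n) * f 0 ≈⟨ ⊛-suc g f n ⟨
    (g ⊛ f) (suc n)                  ∎

  ⊛-assoc : ∀ f g h → (f ⊛ g) ⊛ h ≋ f ⊛ (g ⊛ h)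
  ⊛-assoc f g h zero    =
    solve 3 (λ a b c → (a :* b :+ con 0) :* c :+ con 0 := a :* (b :* c :+ con 0) :+ con 0)
      refl (f 0) (g 0) (h 0)
  ⊛-assoc f g h (suc n) = begin
    (f ⊛ g) 0 * h (suc n) + ((f 0 • tail g ⊕ tail f ⊛ g) ⊛ h) n
      ≈⟨ +-congˡ (⊛-distribʳ h (f 0 • tail g) (tail f ⊛ g) n) ⟩
    (f ⊛ g) 0 * h (suc n) + (((f 0 • tail g) ⊛ h) n + ((tail f ⊛ g) ⊛ h) n)
      ≈⟨ +-congˡ (+-cong (•-⊛ (f 0) (tail g) h n) (⊛-assoc (tail f) g h n)) ⟩
    (f 0 * g 0 + 0#) * h (suc n) + (f 0 * (tail g ⊛ h) n + (tail f ⊛ (g ⊛ h)) n)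
      ≈⟨ solve 5 (λ a b c x y → (a :* b :+ con 0) :* c :+ (a :* x :+ y) := a :* (b :* c :+ x) :+ y)
           refl (f 0) (g 0) (h (suc n)) _ _ ⟩
    f 0 * (g 0 * h (suc n) + (tail g ⊛ h) n) + (tail f ⊛ (g ⊛ h)) n ∎

  isCommutativeRing : IsCommutativeRing _≋_ _⊕_ _⊛_ ⊝_ 𝟘 𝟙
  isCommutativeRing = record
    { isRing = record
      { +-isAbelianGroup = record
        { isGroup = record
          { isMonoid = record
            { isSemigroup = record
              { isMagma = record
                { isEquivalence = record { refl = ≋-refl ; sym = ≋-sym ; trans = ≋-trans }
                ; ∙-cong = λ f≋f′ g≋g′ n → +-cong (f≋f′ n) (g≋g′ n) }
              ; assoc = λ f g h n → +-assoc (f n) (g n) (h n) }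
            ; identity = (λ f n → +-identityˡ (f n)) , (λ f n → +-identityʳ (f n)) }
          ; inverse = (λ f n → -‿inverseˡ (f n)) , (λ f n → -‿inverseʳ (f n))
          ; ⁻¹-cong = λ f≋g n → -‿cong (f≋g n) }
        ; comm = λ f g n → +-comm (f n) (g n) }
      ; *-cong = ⊛-cong
      ; *-assoc = ⊛-assoc
      ; *-identity = ⊛-identityˡ , (λ f → ≋-trans (⊛-comm f 𝟙) (⊛-identityˡ f))
      ; distrib = (λ f g h → ⊛-distribˡ f g h) , ⊛-distribʳ }
    ; *-comm = ⊛-comm }

  commutativeRing : CommutativeRing c ℓ
  commutativeRing = record { isCommutativeRing = isCommutativeRing }

  X : Series
  X = shift 𝟙

  shift-cong : ∀ {f g} → f ≋ g → shift f ≋ shift g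
  shift-cong f≋g zero    = refl
  shift-cong f≋g (suc n) = f≋g n

  shift-⊛ : ∀ f g → shift f ⊛ g ≋ shift (f ⊛ g)
  shift-⊛ f g zero    = trans (+-identityʳ _) (zeroˡ _)
  shift-⊛ f g (suc n) = trans (+-cong (zeroˡ _) refl) (+-identityˡ _)

  X-⊛ : ∀ f → X ⊛ f ≋ shift f
  X-⊛ f = ≋-trans (shift-⊛ 𝟙 f) (shift-cong (⊛-identityˡ f))

  ≋-1+X⊛ : ∀ {f g} → f 0 ≈ 1# → (∀ n → f (suc n) ≈ g n) → f ≋ 𝟙 ⊕ X ⊛ g
  ≋-1+X⊛ {g = g} f₀≈1 f′≈g zero    = trans f₀≈1 (sym (trans (+-congˡ (X-⊛ g 0)) (+-identityʳ 1#)))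
  ≋-1+X⊛ {g = g} f₀≈1 f′≈g (suc n) = trans (f′≈g n) (sym (trans (+-congˡ (X-⊛ g (suc n))) (+-identityˡ (g n))))

  const-⊛ : ∀ a g → const a ⊛ g ≋ a • g
  const-⊛ a g zero    = +-identityʳ _
  const-⊛ a g (suc n) = trans (+-congˡ (⊛-zeroˡ g n)) (+-identityʳ _)

  const-cong : ∀ {a b} → a ≈ b → const a ≋ const b
  const-cong a≈b zero    = a≈b
  const-cong a≈b (suc n) = refl

  const-+ : ∀ a b → const (a + b) ≋ const a ⊕ const b
  const-+ a b zero    = refl
  const-+ a b (suc n) = sym (+-identityʳ 0#)

  const-⊝ : ∀ a → const (- a) ≋ ⊝ const a
  const-⊝ a zero    = refl
  const-⊝ a (suc n) = sym -0#≈0#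
    where open import Algebra.Properties.Ring ring using (-0#≈0#)

  •-const : ∀ a b → a • const b ≋ const (a * b)
  •-const a b zero    = refl
  •-const a b (suc n) = zeroʳ a

  const-* : ∀ a b → const (a * b) ≋ const a ⊛ const b
  const-* a b = ≋-sym (≋-trans (const-⊛ a (const b)) (•-const a b))

  monomial : ℕ → Carrier → Series
  monomial zero    a = const a
  monomial (suc k) a = shift (monomial k a)

  monomial-cong : ∀ k {a b} → a ≈ b → monomial k a ≋ monomial k b
  monomial-cong zero    a≈b = const-cong a≈b
  monomial-cong (suc k) a≈b = shift-cong (monomial-cong k a≈b)

  •-monomial : ∀ a k b → a • monomial k b ≋ monomial k (a * b)
  •-monomial a zero    b = •-const a b
  •-monomial a (suc k) b zero    = zeroʳ a
  •-monomial a (suc k) b (suc n) = •-monomial a k b n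

  monomial-⊛ : ∀ j k a b → monomial j a ⊛ monomial k b ≋ monomial (j ℕ.+ k) (a * b)
  monomial-⊛ zero    k a b = ≋-trans (const-⊛ a (monomial k b)) (•-monomial a k b)
  monomial-⊛ (suc j) k a b = ≋-trans (shift-⊛ (monomial j a) (monomial k b)) (shift-cong (monomial-⊛ j k a b))

  crossTerms : Series → ℕ → Carrier
  crossTerms f zero    = 0#
  crossTerms f (suc m) = (tail f ⊛ tail f) m

  ⊛-self-suc : ∀ f → f 0 ≈ 1# → ∀ m → (f ⊛ f) (suc m) ≈ (f (suc m) + f (suc m)) + crossTerms f m
  ⊛-self-suc f f₀≈1 zero    = begin
    f 0 * f 1 + (f 1 * f 0 + 0#) ≈⟨ +-cong (*-cong f₀≈1 refl) (+-cong (*-cong refl f₀≈1) refl) ⟩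
    1# * f 1 + (f 1 * 1# + 0#)   ≈⟨ solve 1 (λ x → con 1 :* x :+ (x :* con 1 :+ con 0) := (x :+ x) :+ con 0) refl (f 1) ⟩
    (f 1 + f 1) + 0#             ∎
  ⊛-self-suc f f₀≈1 (suc j) = begin
    f 0 * f (2+ j) + (tail f ⊛ f) (suc j)
      ≈⟨ +-congˡ (⊛-suc (tail f) f j) ⟩
    f 0 * f (2+ j) + ((tail f ⊛ tail f) j + f (2+ j) * f 0)
      ≈⟨ +-cong (*-cong f₀≈1 refl) (+-congˡ (*-cong refl f₀≈1)) ⟩
    1# * f (2+ j) + ((tail f ⊛ tail f) j + f (2+ j) * 1#)
      ≈⟨ solve 2 (λ x z → con 1 :* x :+ (z :+ x :* con 1) := (x :+ x) :+ z) refl (f (2+ j)) _ ⟩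
    (f (2+ j) + f (2+ j)) + (tail f ⊛ tail f) j ∎
    where 2+ = λ n → suc (suc n)

  crossTerms-cong : ∀ {f g} m → (∀ {k} → k < suc m → f k ≈ g k) → crossTerms f m ≈ crossTerms g m
  crossTerms-cong zero    _   = refl
  crossTerms-cong (suc j) f≈g = ⊛-cong-≤ j (λ k≤j → f≈g (s≤s (s≤s k≤j))) (λ k≤j → f≈g (s≤s (s≤s k≤j)))

  square-root-unique : (∀ {x y} → x + x ≈ y + y → x ≈ y) →
                       ∀ {f g} → f 0 ≈ 1# → g 0 ≈ 1# → f ⊛ f ≋ g ⊛ g → f ≋ g
  -- coefficient n + 1 of f ⊛ f is 2 f (n + 1) plus cross terms involving only lower coefficients
  square-root-unique cancel-doubling {f} {g} f₀≈1 g₀≈1 f²≋g² = <-rec (λ n → f n ≈ g n) coefficient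
    where
    open import Algebra.Properties.Group +-group using (∙-cancelʳ)
    coefficient : ∀ n → (∀ {k} → k < n → f k ≈ g k) → f n ≈ g n
    coefficient zero    _   = trans f₀≈1 (sym g₀≈1)
    coefficient (suc m) f≈g = cancel-doubling (∙-cancelʳ (crossTerms g m) _ _ (begin
      (f (suc m) + f (suc m)) + crossTerms g m ≈⟨ +-congˡ (crossTerms-cong m f≈g) ⟨
      (f (suc m) + f (suc m)) + crossTerms f m ≈⟨ ⊛-self-suc f f₀≈1 m ⟨
      (f ⊛ f) (suc m)                     ≈⟨ f²≋g² (suc m) ⟩
      (g ⊛ g) (suc m)                     ≈⟨ ⊛-self-suc g g₀≈1 m ⟩
      (g (suc m) + g (suc m)) + crossTerms g m ∎))

-- A polynomial in k + 1 variables is a power series in its first variable over polynomials in k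
-- variables, and toSeries is an injective ring homomorphism, so the ring laws follow by induction on k.
module MvPolynomial where
  open import Algebra.Core using (Op₁; Op₂)
  open import Algebra.Morphism.Structures using (IsRingMonomorphism)
  import Algebra.Morphism.RingMonomorphism as RingMonomorphism
  open import Data.List using (upTo)
  open import Data.Vec.Properties using (≡-dec)
  open import Data.Bool using (if_then_else_)
  open import Relation.Nullary using (does)
  open import Defs using (Σℤ; below)

  MvPoly : ℕ → Set
  MvPoly k = Vec ℕ k → ℤ

  module _ {k : ℕ} where

    infix  4 _≈_
    infixl 6 _+_
    infixl 7 _*_
    infix  8 -_

    _≈_ : Rel (MvPoly k) 0ℓ
    p ≈ r = ∀ α → p α ≡ r α

    _+_ _*_ : Op₂ (MvPoly k)
    (p + r) α = p α ℤ.+ r α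
    (p * r) α = Σℤ (map (λ β → p β ℤ.* r (zipWith _∸_ α β)) (below α))

    -_ : Op₁ (MvPoly k)
    (- p) α = ℤ.- p α

    0# : MvPoly k
    0# _ = 0ℤ

  constant : ∀ {k} → ℤ → MvPoly k
  constant z []          = z
  constant z (zero  ∷ α) = constant z α
  constant z (suc _ ∷ α) = 0ℤ

  1# : ∀ {k} → MvPoly k
  1# = constant 1ℤ

  monomial : ∀ {k} → Vec ℕ k → MvPoly k
  monomial α β = if does (≡-dec ℕ._≟_ β α) then 1ℤ else 0ℤ

  rawRing : ℕ → RawRing 0ℓ 0ℓ
  rawRing k = record { Carrier = MvPoly k ; _≈_ = _≈_ ; _+_ = _+_ ; _*_ = _*_ ; -_ = -_ ; 0# = 0# ; 1# = 1# }

  toSeries : ∀ {k} → MvPoly (suc k) → ℕ → MvPoly k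
  toSeries p n α = p (n ∷ α)

  toSeries-injective : ∀ {k} {p r : MvPoly (suc k)} → (∀ n → toSeries p n ≈ toSeries r n) → p ≈ r
  toSeries-injective p≋r (n ∷ α) = p≋r n α

  private
    module ℤ∑ = Sums ℤ.+-*-semiring

  Σℤ≡∑ : ∀ zs → Σℤ zs ≡ ℤ∑.∑ zs
  Σℤ≡∑ []       = ≡.refl
  Σℤ≡∑ (z ∷ zs) = ≡.cong (λ t → z ℤ.+ t) (Σℤ≡∑ zs)

  at[]-isRingMonomorphism : IsRingMonomorphism (rawRing 0) (CommutativeRing.rawRing ℤ.+-*-commutativeRing) (λ p → p [])
  at[]-isRingMonomorphism = record
    { isRingHomomorphism = record
      { isSemiringHomomorphism = record
        { isNearSemiringHomomorphism = record
          { +-isMonoidHomomorphism = record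
            { isMagmaHomomorphism = record
              { isRelHomomorphism = record { cong = λ p≈r → p≈r [] }
              ; homo = λ _ _ → ≡.refl }
            ; ε-homo = ≡.refl }
          ; *-homo = λ _ _ → ℤ.+-identityʳ _ }
        ; 1#-homo = ≡.refl }
      ; -‿homo = λ _ → ≡.refl }
    ; injective = λ { p[]≡r[] [] → p[]≡r[] } }

  IsCommutativeRingOn : ℕ → Set
  IsCommutativeRingOn k = IsCommutativeRing (_≈_ {k}) _+_ _*_ -_ 0# 1#

  ringFrom : ∀ {k} → IsCommutativeRingOn k → CommutativeRing 0ℓ 0ℓ
  ringFrom {k} isCommRing = record
    { Carrier = MvPoly k ; _≈_ = _≈_ ; _+_ = _+_ ; _*_ = _*_ ; -_ = -_ ; 0# = 0# ; 1# = 1#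
    ; isCommutativeRing = isCommRing }

  -- The product formula does not use the ring laws; it is stated over any ring structure on MvPoly k
  -- because it is needed to construct the one on MvPoly (suc k).
  module _ {k} (isCommRing : IsCommutativeRingOn k) where
    open PowerSeries (ringFrom isCommRing) using (_⊛_; commutativeRing)
    open Sums (CommutativeRing.semiring (ringFrom isCommRing)) using (∑)

    toSeries-* : ∀ (p r : MvPoly (suc k)) n → toSeries (p * r) n ≈ (toSeries p ⊛ toSeries r) n
    toSeries-* p r n α = begin
      Σℤ (map F (concatMap firstExponent (upTo (suc n))))
        ≡⟨ Σℤ≡∑ (map F (concatMap firstExponent (upTo (suc n)))) ⟩
      ℤ∑.∑ (map F (concatMap firstExponent (upTo (suc n))))
        ≡⟨ ℤ∑.∑-concatMap F firstExponent (upTo (suc n)) ⟩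
      ℤ∑.∑ (map (λ i → ℤ∑.∑ (map F (firstExponent i))) (upTo (suc n)))
        ≡⟨ ≡.cong ℤ∑.∑ (List.map-cong coefficient (upTo (suc n))) ⟩
      ℤ∑.∑ (map (λ i → h i α) (upTo (suc n)))
        ≡⟨ ≡.cong ℤ∑.∑ (List.map-∘ {g = λ q → q α} {f = h} (upTo (suc n))) ⟩
      ℤ∑.∑ (map (λ q → q α) (map h (upTo (suc n))))
        ≡⟨ ≡.cong (λ qs → ℤ∑.∑ (map (λ q → q α) qs)) (List.map-upTo h (suc n)) ⟩
      ℤ∑.∑ (map (λ q → q α) (applyUpTo h (suc n)))
        ≡⟨ ∑-apply (applyUpTo h (suc n)) ⟨
      ∑ (applyUpTo h (suc n)) α ∎
      where
      open ≡.≡-Reasoning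
      F : Vec ℕ (suc k) → ℤ
      F β = p β ℤ.* r (zipWith _∸_ (n ∷ α) β)
      firstExponent : ℕ → List (Vec ℕ (suc k))
      firstExponent i = map (i ∷_) (below α)
      h : ℕ → MvPoly k
      h i = toSeries p i * toSeries r (n ∸ i)
      coefficient : ∀ i → ℤ∑.∑ (map F (firstExponent i)) ≡ h i α
      coefficient i = ≡.trans (≡.sym (Σℤ≡∑ (map F (firstExponent i)))) (≡.cong Σℤ (≡.sym (List.map-∘ (below α))))
      ∑-apply : ∀ qs → ∑ qs α ≡ ℤ∑.∑ (map (λ q → q α) qs)
      ∑-apply []       = ≡.refl
      ∑-apply (q ∷ qs) = ≡.cong (λ t → q α ℤ.+ t) (∑-apply qs)

    toSeries-isRingMonomorphism : IsRingMonomorphism (rawRing (suc k)) (CommutativeRing.rawRing commutativeRing) toSeries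
    toSeries-isRingMonomorphism = record
      { isRingHomomorphism = record
        { isSemiringHomomorphism = record
          { isNearSemiringHomomorphism = record
            { +-isMonoidHomomorphism = record
              { isMagmaHomomorphism = record
                { isRelHomomorphism = record { cong = λ p≈r n α → p≈r (n ∷ α) }
                ; homo = λ _ _ n α → ≡.refl }
              ; ε-homo = λ n α → ≡.refl }
            ; *-homo = toSeries-* }
          ; 1#-homo = λ { zero α → ≡.refl ; (suc n) α → ≡.refl } }
        ; -‿homo = λ _ n α → ≡.refl }
      ; injective = toSeries-injective }

  isCommutativeRing : ∀ k → IsCommutativeRingOn k
  isCommutativeRing zero    =
    RingMonomorphism.isCommutativeRing at[]-isRingMonomorphism ℤ.+-*-isCommutativeRing
  isCommutativeRing (suc k) =
    RingMonomorphism.isCommutativeRing (toSeries-isRingMonomorphism (isCommutativeRing k))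
      (PowerSeries.isCommutativeRing (ringFrom (isCommutativeRing k)))

  ring : ℕ → CommutativeRing 0ℓ 0ℓ
  ring k = ringFrom (isCommutativeRing k)

  module _ {k : ℕ} where
    open PowerSeries (ring k) using (_≋_)

    toSeries-monomial : ∀ a α → toSeries (monomial (a ∷ α)) ≋ PowerSeries.monomial (ring k) a (monomial α)
    toSeries-monomial zero    α zero    γ = ≡.refl
    toSeries-monomial zero    α (suc n) γ = ≡.refl
    toSeries-monomial (suc a) α zero    γ = ≡.refl
    toSeries-monomial (suc a) α (suc n) γ = toSeries-monomial a α n γ

  monomial-zero : ∀ {k} → monomial (replicate k 0) ≈ 1#
  monomial-zero {zero}  []          = ≡.refl
  monomial-zero {suc k} (zero  ∷ γ) = monomial-zero {k} γ
  monomial-zero {suc k} (suc n ∷ γ) = ≡.refl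

  monomial-+ : ∀ {k} (α β : Vec ℕ k) → monomial (zipWith ℕ._+_ α β) ≈ monomial α * monomial β
  monomial-+ []      []      [] = ≡.refl
  monomial-+ {suc k} (a ∷ α) (b ∷ β) = toSeries-injective (begin
    toSeries (monomial (a ℕ.+ b ∷ zipWith ℕ._+_ α β))    ≈⟨ toSeries-monomial (a ℕ.+ b) _ ⟩
    S.monomial (a ℕ.+ b) (monomial (zipWith ℕ._+_ α β)) ≈⟨ S.monomial-cong (a ℕ.+ b) (monomial-+ α β) ⟩
    S.monomial (a ℕ.+ b) (monomial α * monomial β)      ≈⟨ S.monomial-⊛ a b _ _ ⟨
    S.monomial a (monomial α) S.⊛ S.monomial b (monomial β)
      ≈⟨ S.⊛-cong (toSeries-monomial a α) (toSeries-monomial b β) ⟨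
    toSeries (monomial (a ∷ α)) S.⊛ toSeries (monomial (b ∷ β))
      ≈⟨ toSeries-* (isCommutativeRing k) (monomial (a ∷ α)) (monomial (b ∷ β)) ⟨
    toSeries (monomial (a ∷ α) * monomial (b ∷ β)) ∎)
    where
    module S = PowerSeries (ring k)
    open import Relation.Binary.Reasoning.Setoid (CommutativeRing.setoid S.commutativeRing)

module GeneratingFunctions {c ℓ} (R : CommutativeRing c ℓ) where
  open CommutativeRing R
  open IntegerCoefficients R using (fromℤ; fromℤ-morphism)
  open import Data.Maybe using (Maybe; just; nothing)
  open import Relation.Nullary using (yes; no)

  private
    coefficient≟ : ∀ a b → Maybe (fromℤ a ≈ fromℤ b)
    coefficient≟ a b with a ℤ.≟ b
    ... | yes ≡.refl = just refl
    ... | no _       = nothing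

  open import Algebra.Solver.Ring ℤ.+-*-rawRing (fromCommutativeRing R) fromℤ-morphism coefficient≟
    using (solve; _:=_; _:+_; _:*_; _:-_; :-_; con)

  2# : Carrier
  2# = 1# + 1#

  module Quadratic (q x₂ y₂ p e : Carrier) where

    numerator radicand : Carrier
    numerator = 1# + ((y₂ - x₂) * q + (e - p) * (q * q))
    radicand  = 1# + (- (2# * (x₂ + y₂)) * q
                  + (((x₂ + y₂) * (x₂ + y₂) - 2# * (p + e)) * (q * q)
                  + ((2# * ((p - e) * (x₂ - y₂))) * (q * (q * q))
                  + ((p - e) * (p - e)) * (q * (q * (q * q))))))

    module _ (T U : Carrier) where

      V W G root : Carrier
      V    = (T + x₂) - 1#
      W    = e + y₂ * (T - 1#)
      G    = (T + (y₂ - 1#)) + q * (e - p)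
      root = numerator - (2# * q) * G

      root-expansion : root ≈ 1# + q * (((y₂ - x₂) + (e - p) * q) - 2# * G)
      root-expansion = solve 7 (λ q x₂ y₂ p e T U →
        let two = con 1ℤ :+ con 1ℤ
            G   = (T :+ (y₂ :- con 1ℤ)) :+ q :* (e :- p)
        in  (con 1ℤ :+ ((y₂ :- x₂) :* q :+ (e :- p) :* (q :* q))) :- (two :* q) :* G
            := con 1ℤ :+ q :* (((y₂ :- x₂) :+ (e :- p) :* q) :- two :* G)) refl q x₂ y₂ p e T U

      root-squared : root * root ≈ radicand - ((2# * 2#) * q) *
        ((1# - q * V) * (T - (1# + q * ((p - e) + W * U))) + (q * W) * (U - (1# + q * (V * U))))
      root-squared = solve 7 (λ q x₂ y₂ p e T U →
        let one = con 1ℤ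
            two = one :+ one
            V   = (T :+ x₂) :- one
            W   = e :+ y₂ :* (T :- one)
            G   = (T :+ (y₂ :- one)) :+ q :* (e :- p)
            root = (one :+ ((y₂ :- x₂) :* q :+ (e :- p) :* (q :* q))) :- (two :* q) :* G
            radicand = one :+ ((:- (two :* (x₂ :+ y₂))) :* q
                  :+ (((x₂ :+ y₂) :* (x₂ :+ y₂) :- two :* (p :+ e)) :* (q :* q)
                  :+ ((two :* ((p :- e) :* (x₂ :- y₂))) :* (q :* (q :* q))
                  :+ ((p :- e) :* (p :- e)) :* (q :* (q :* (q :* q))))))
        in  root :* root := radicand :- ((two :* two) :* q) :*
              ((one :- q :* V) :* (T :- (one :+ q :* ((p :- e) :+ W :* U))) :+ (q :* W) :* (U :- (one :+ q :* (V :* U)))))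
        refl q x₂ y₂ p e T U

      root²≈radicand : T ≈ 1# + q * ((p - e) + W * U) → U ≈ 1# + q * (V * U) → root * root ≈ radicand
      root²≈radicand T-eq U-eq = begin
        root * root
          ≈⟨ root-squared ⟩
        radicand - ((2# * 2#) * q) * ((1# - q * V) * (T - _) + (q * W) * (U - _))
          ≈⟨ +-congˡ (-‿cong (*-congˡ (+-cong (*-congˡ (x≈y⇒x∙y⁻¹≈ε T-eq)) (*-congˡ (x≈y⇒x∙y⁻¹≈ε U-eq))))) ⟩
        radicand - ((2# * 2#) * q) * ((1# - q * V) * 0# + (q * W) * 0#)
          ≈⟨ +-congˡ (-‿cong (trans (*-congˡ (trans (+-cong (zeroʳ _) (zeroʳ _)) (+-identityʳ 0#))) (zeroʳ _))) ⟩
        radicand - 0#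
          ≈⟨ trans (+-congˡ -0#≈0#) (+-identityʳ radicand) ⟩
        radicand ∎
        where
        open import Relation.Binary.Reasoning.Setoid setoid
        open import Algebra.Properties.Ring ring using (-0#≈0#; x≈y⇒x∙y⁻¹≈ε)

module Forests where
  open import Defs using (PTree; node; forestsF; planeTrees)
  open import Data.Nat.Properties using (≤-refl; ≤-trans; m∸n≤m; ≤-pred)
  open import Data.List using (concat; upTo)
  open import Data.List.Relation.Unary.All.Properties using (applyUpTo⁺₁)

  forests : ℕ → List (List PTree)
  forests n = forestsF n n

  forestsF-fuel : ∀ {f g} n → n ≤ f → n ≤ g → forestsF f n ≡ forestsF g n
  forestsF-fuel zero _ _ = ≡.refl
  forestsF-fuel {suc f} {suc g} (suc n) (s≤s n≤f) (s≤s n≤g) =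
    ≡.cong concat (List.map-cong-local (applyUpTo⁺₁ id (suc n) λ {k} k<1+n →
      let k≤n = ≤-pred k<1+n in
      ≡.cong₂ (λ ts rs → concatMap (λ t → map (t ∷_) rs) (map node ts))
        (forestsF-fuel k (≤-trans k≤n n≤f) (≤-trans k≤n n≤g))
        (forestsF-fuel (n ∸ k) (≤-trans (m∸n≤m n k) n≤f) (≤-trans (m∸n≤m n k) n≤g))))

  forests-suc : ∀ n → forests (suc n) ≡
    concatMap (λ k → concatMap (λ t → map (t ∷_) (forests (n ∸ k))) (planeTrees k)) (upTo (suc n))
  forests-suc n = ≡.cong concat (List.map-cong-local (applyUpTo⁺₁ id (suc n) λ {k} k<1+n →
    ≡.cong₂ (λ ts rs → concatMap (λ t → map (t ∷_) rs) (map node ts))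
      (forestsF-fuel k (≤-pred k<1+n) ≤-refl)
      (forestsF-fuel (n ∸ k) (m∸n≤m n k) ≤-refl)))

-- m stands for Defs.mono; all that is used is that it turns sums of exponent vectors into products
module WeightedTrees {c ℓ} (R : CommutativeRing c ℓ) (m : Vec ℕ 6 → CommutativeRing.Carrier R)
  (m-+ : ∀ α β → CommutativeRing._≈_ R (m (zipWith ℕ._+_ α β)) (CommutativeRing._*_ R (m α) (m β)))
  (m-0 : CommutativeRing._≈_ R (m (replicate 6 0)) (CommutativeRing.1# R)) where
  open CommutativeRing R
  open Sums semiring
  open PowerSeries R using (Series; _≋_; _⊕_; ⊝_; _⊛_; 𝟙; X; const; ≋-refl; ≋-trans; ⊛-cong; ≋-1+X⊛; X-⊛; const-⊛; const-+; const-⊝)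
  open Forests
  open import Algebra.Properties.Ring ring using (-0#≈0#; xyx⁻¹≈y)
  open import Defs using (PTree; node; planeTrees; countV; countF; leavesIn; sleafL; eleafL; yleafL; sintL; eintL; yintL)
  open import Algebra.Properties.CommutativeSemigroup *-commutativeSemigroup using (interchange; x∙yz≈y∙xz)
  open import Relation.Binary.Reasoning.Setoid setoid
  open import Data.List using (upTo)

  byFirstTree : (List PTree → Carrier) → ℕ → ℕ → Carrier
  byFirstTree F n k = ∑ (map (λ t → ∑ (map (λ r → F (t ∷ r)) (forests (n ∸ k)))) (planeTrees k))

  ∑-forests-suc : ∀ F n → ∑ (map F (forests (suc n))) ≈ ∑ (applyUpTo (byFirstTree F n) (suc n))
  ∑-forests-suc F n = begin
    ∑ (map F (forests (suc n)))                             ≡⟨ ≡.cong (∑ ∘ map F) (forests-suc n) ⟩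
    ∑ (map F (concatMap firstTree (upTo (suc n))))          ≈⟨ ∑-concatMap F firstTree (upTo (suc n)) ⟩
    ∑ (map (λ k → ∑ (map F (firstTree k))) (upTo (suc n)))  ≈⟨ ∑-map-cong split (upTo (suc n)) ⟩
    ∑ (map (byFirstTree F n) (upTo (suc n)))                ≡⟨ ≡.cong ∑ (List.map-upTo (byFirstTree F n) (suc n)) ⟩
    ∑ (applyUpTo (byFirstTree F n) (suc n))                 ∎
    where
    firstTree : ℕ → List (List PTree)
    firstTree k = concatMap (λ t → map (t ∷_) (forests (n ∸ k))) (planeTrees k)
    split : ∀ k → ∑ (map F (firstTree k)) ≈ byFirstTree F n k
    split k = trans (∑-concatMap F _ (planeTrees k))
      (∑-map-cong (λ t → reflexive (≡.cong ∑ (≡.sym (List.map-∘ (forests (n ∸ k)))))) (planeTrees k))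

  ∑-forests-suc-cong : ∀ {F G : List PTree → Carrier} n → (∀ t r → F (t ∷ r) ≈ G (t ∷ r)) →
                       ∑ (map F (forests (suc n))) ≈ ∑ (map G (forests (suc n)))
  ∑-forests-suc-cong {F} {G} n F≈G = begin
    ∑ (map F (forests (suc n)))
      ≈⟨ ∑-forests-suc F n ⟩
    ∑ (applyUpTo (byFirstTree F n) (suc n))
      ≈⟨ ∑-applyUpTo-cong (λ k → ∑-map-cong (λ t → ∑-map-cong (F≈G t) (forests (n ∸ k))) (planeTrees k)) (suc n) ⟩
    ∑ (applyUpTo (byFirstTree G n) (suc n))
      ≈⟨ ∑-forests-suc G n ⟨
    ∑ (map G (forests (suc n))) ∎

  statistics : {A : Set} → ((List PTree → ℕ) → A → ℕ) → A → Vec ℕ 6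
  statistics count x =
    count sleafL x ∷ count eleafL x ∷ count yleafL x ∷ count sintL x ∷ count eintL x ∷ count yintL x ∷ []

  weight : PTree → Carrier
  weight t = m (statistics countV t)

  ∏weight : List PTree → Carrier
  ∏weight []       = 1#
  ∏weight (t ∷ ts) = weight t * ∏weight ts

  m-statistics-countF : ∀ ts → m (statistics countF ts) ≈ ∏weight ts
  m-statistics-countF []       = m-0
  m-statistics-countF (t ∷ ts) =
    trans (m-+ (statistics countV t) (statistics countF ts)) (*-congˡ (m-statistics-countF ts))

  weight-node : ∀ ts → weight (node ts) ≈ m (statistics id ts) * ∏weight ts
  weight-node ts = trans (m-+ (statistics id ts) (statistics countF ts)) (*-congˡ (m-statistics-countF ts))

  x11 x12 x2 y11 y12 y2 : Carrier
  x11 = m (1 ∷ 0 ∷ 0 ∷ 0 ∷ 0 ∷ 0 ∷ [])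
  x12 = m (0 ∷ 1 ∷ 0 ∷ 0 ∷ 0 ∷ 0 ∷ [])
  x2  = m (0 ∷ 0 ∷ 1 ∷ 0 ∷ 0 ∷ 0 ∷ [])
  y11 = m (0 ∷ 0 ∷ 0 ∷ 1 ∷ 0 ∷ 0 ∷ [])
  y12 = m (0 ∷ 0 ∷ 0 ∷ 0 ∷ 1 ∷ 0 ∷ [])
  y2  = m (0 ∷ 0 ∷ 0 ∷ 0 ∷ 0 ∷ 1 ∷ [])

  x2^ : ℕ → Carrier
  x2^ L = m (0 ∷ 0 ∷ L ∷ 0 ∷ 0 ∷ 0 ∷ [])

  -- the weight of the children after the first one, all of whose leaves are young
  tailWeight : List PTree → Carrier
  tailWeight r = x2^ (leavesIn r) * ∏weight r

  leafMark : PTree → Carrier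
  leafMark (node [])      = x2
  leafMark (node (_ ∷ _)) = 1#

  tailWeight-∷ : ∀ t r → tailWeight (t ∷ r) ≈ (leafMark t * weight t) * tailWeight r
  tailWeight-∷ (node []) r = begin
    x2^ (suc L) * (weight (node []) * ∏weight r)
      ≈⟨ *-congʳ (m-+ (0 ∷ 0 ∷ 1 ∷ 0 ∷ 0 ∷ 0 ∷ []) (0 ∷ 0 ∷ L ∷ 0 ∷ 0 ∷ 0 ∷ [])) ⟩
    (x2 * x2^ L) * (weight (node []) * ∏weight r)
      ≈⟨ interchange x2 (x2^ L) (weight (node [])) (∏weight r) ⟩
    (x2 * weight (node [])) * (x2^ L * ∏weight r) ∎
    where L = leavesIn r
  tailWeight-∷ (node (t ∷ ts)) r = begin
    x2^ L * (weight (node (t ∷ ts)) * ∏weight r)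
      ≈⟨ x∙yz≈y∙xz (x2^ L) (weight (node (t ∷ ts))) (∏weight r) ⟩
    weight (node (t ∷ ts)) * (x2^ L * ∏weight r)
      ≈⟨ *-congʳ (*-identityˡ (weight (node (t ∷ ts)))) ⟨
    (1# * weight (node (t ∷ ts))) * tailWeight r ∎
    where L = leavesIn r

  weight-leaf : weight (node []) ≈ 1#
  weight-leaf = m-0

  weight-edge : weight (node (node [] ∷ [])) ≈ x11 * y11
  weight-edge = m-+ (1 ∷ 0 ∷ 0 ∷ 0 ∷ 0 ∷ 0 ∷ []) (0 ∷ 0 ∷ 0 ∷ 1 ∷ 0 ∷ 0 ∷ [])

  weight-elder : ∀ r rs → weight (node (node [] ∷ r ∷ rs)) ≈ (x12 * y12) * tailWeight (r ∷ rs)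
  weight-elder r rs = begin
    weight (node (node [] ∷ r ∷ rs))                    ≈⟨ weight-node (node [] ∷ r ∷ rs) ⟩
    m (0 ∷ 1 ∷ L ∷ 0 ∷ 1 ∷ 0 ∷ []) * (weight (node []) * ∏weight (r ∷ rs))
      ≈⟨ *-cong (m-+ (0 ∷ 1 ∷ 0 ∷ 0 ∷ 1 ∷ 0 ∷ []) (0 ∷ 0 ∷ L ∷ 0 ∷ 0 ∷ 0 ∷ []))
                (trans (*-congʳ weight-leaf) (*-identityˡ (∏weight (r ∷ rs)))) ⟩
    (m (0 ∷ 1 ∷ 0 ∷ 0 ∷ 1 ∷ 0 ∷ []) * x2^ L) * ∏weight (r ∷ rs)
      ≈⟨ *-assoc (m (0 ∷ 1 ∷ 0 ∷ 0 ∷ 1 ∷ 0 ∷ [])) (x2^ L) (∏weight (r ∷ rs)) ⟩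
    m (0 ∷ 1 ∷ 0 ∷ 0 ∷ 1 ∷ 0 ∷ []) * tailWeight (r ∷ rs)
      ≈⟨ *-congʳ (m-+ (0 ∷ 1 ∷ 0 ∷ 0 ∷ 0 ∷ 0 ∷ []) (0 ∷ 0 ∷ 0 ∷ 0 ∷ 1 ∷ 0 ∷ [])) ⟩
    (x12 * y12) * tailWeight (r ∷ rs)                   ∎
    where L = leavesIn (r ∷ rs)

  weight-young : ∀ t ts r → weight (node (node (t ∷ ts) ∷ r)) ≈ (y2 * weight (node (t ∷ ts))) * tailWeight r
  weight-young t ts r = begin
    weight (node (node (t ∷ ts) ∷ r))
      ≈⟨ weight-node (node (t ∷ ts) ∷ r) ⟩
    m (0 ∷ 0 ∷ L ∷ 0 ∷ 0 ∷ 1 ∷ []) * (weight (node (t ∷ ts)) * ∏weight r)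
      ≈⟨ *-congʳ (m-+ (0 ∷ 0 ∷ 0 ∷ 0 ∷ 0 ∷ 1 ∷ []) (0 ∷ 0 ∷ L ∷ 0 ∷ 0 ∷ 0 ∷ [])) ⟩
    (y2 * x2^ L) * (weight (node (t ∷ ts)) * ∏weight r)
      ≈⟨ interchange y2 (x2^ L) (weight (node (t ∷ ts))) (∏weight r) ⟩
    (y2 * weight (node (t ∷ ts))) * tailWeight r ∎
    where L = leavesIn r

  T U V W : Series
  T n = ∑ (map weight (planeTrees n))
  U n = ∑ (map tailWeight (forests n))
  V n = ∑ (map (λ t → leafMark t * weight t) (planeTrees n))
  W zero    = x12 * y12
  W (suc n) = y2 * T (suc n)

  T-zero : T 0 ≈ 1#
  T-zero = trans (+-identityʳ (weight (node []))) weight-leaf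

  U-zero : U 0 ≈ 1#
  U-zero = trans (+-identityʳ (tailWeight [])) (trans (*-identityʳ (x2^ 0)) m-0)

  V-zero : V 0 ≈ x2
  V-zero = trans (+-identityʳ (x2 * weight (node []))) (trans (*-congˡ weight-leaf) (*-identityʳ x2))

  V-suc : ∀ n → V (suc n) ≈ T (suc n)
  V-suc n = begin
    ∑ (map (λ t → leafMark t * weight t) (map node (forests (suc n))))
      ≡⟨ ≡.cong ∑ (List.map-∘ (forests (suc n))) ⟨
    ∑ (map (λ ts → leafMark (node ts) * weight (node ts)) (forests (suc n)))
      ≈⟨ ∑-forests-suc-cong n (λ t r → *-identityˡ (weight (node (t ∷ r)))) ⟩
    ∑ (map (weight ∘ node) (forests (suc n)))
      ≡⟨ ≡.cong ∑ (List.map-∘ (forests (suc n))) ⟩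
    T (suc n) ∎

  U-suc : ∀ n → U (suc n) ≈ (V ⊛ U) n
  U-suc n = trans (∑-forests-suc tailWeight n) (∑-applyUpTo-cong split (suc n))
    where
    split : ∀ k → byFirstTree tailWeight n k ≈ V k * U (n ∸ k)
    split k = trans (∑-map-cong (λ t → ∑-map-cong (tailWeight-∷ t) (forests (n ∸ k))) (planeTrees k))
                    (sym (∑-* (λ t → leafMark t * weight t) tailWeight (planeTrees k) (forests (n ∸ k))))

  firstChildLeaf : ∀ n → byFirstTree (weight ∘ node) n 0 ≈ const (x11 * y11 - x12 * y12) n + W 0 * U n
  firstChildLeaf zero = begin
    (weight (node (node [] ∷ [])) + 0#) + 0#     ≈⟨ trans (+-identityʳ _) (trans (+-identityʳ _) weight-edge) ⟩
    x11 * y11                                    ≈⟨ +-identityʳ (x11 * y11) ⟨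
    x11 * y11 + 0#                               ≈⟨ +-congˡ (-‿inverseˡ (x12 * y12)) ⟨
    x11 * y11 + (- (x12 * y12) + x12 * y12)      ≈⟨ +-assoc (x11 * y11) (- (x12 * y12)) (x12 * y12) ⟨
    (x11 * y11 - x12 * y12) + x12 * y12          ≈⟨ +-congˡ (trans (*-congˡ U-zero) (*-identityʳ (x12 * y12))) ⟨
    (x11 * y11 - x12 * y12) + x12 * y12 * U 0    ∎
  firstChildLeaf (suc n) = begin
    ∑ (map (λ r → weight (node (node [] ∷ r))) (forests (suc n))) + 0#
      ≈⟨ +-identityʳ _ ⟩
    ∑ (map (λ r → weight (node (node [] ∷ r))) (forests (suc n)))
      ≈⟨ ∑-forests-suc-cong n weight-elder ⟩
    ∑ (map (λ r → (x12 * y12) * tailWeight r) (forests (suc n)))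
      ≈⟨ *-distribˡ-∑ (x12 * y12) tailWeight (forests (suc n)) ⟨
    x12 * y12 * U (suc n)
      ≈⟨ +-identityˡ _ ⟨
    0# + x12 * y12 * U (suc n) ∎

  firstChildInterior : ∀ n j → byFirstTree (weight ∘ node) n (suc j) ≈ W (suc j) * U (n ∸ suc j)
  firstChildInterior n j = begin
    ∑ (map (λ t → ∑ (map (λ r → weight (node (t ∷ r))) rest)) (map node (forests (suc j))))
      ≡⟨ ≡.cong ∑ (List.map-∘ (forests (suc j))) ⟨
    ∑ (map (λ ts → ∑ (map (λ r → weight (node (node ts ∷ r))) rest)) (forests (suc j)))
      ≈⟨ ∑-forests-suc-cong j (λ t ts → ∑-map-cong (weight-young t ts) rest) ⟩
    ∑ (map (λ ts → ∑ (map (λ r → (y2 * weight (node ts)) * tailWeight r) rest)) (forests (suc j)))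
      ≈⟨ ∑-* (λ ts → y2 * weight (node ts)) tailWeight (forests (suc j)) rest ⟨
    ∑ (map (λ ts → y2 * weight (node ts)) (forests (suc j))) * U (n ∸ suc j)
      ≈⟨ *-congʳ (*-distribˡ-∑ y2 (weight ∘ node) (forests (suc j))) ⟨
    (y2 * ∑ (map (weight ∘ node) (forests (suc j)))) * U (n ∸ suc j)
      ≡⟨ ≡.cong (λ ws → (y2 * ∑ ws) * U (n ∸ suc j)) (List.map-∘ (forests (suc j))) ⟩
    W (suc j) * U (n ∸ suc j) ∎
    where rest = forests (n ∸ suc j)

  T-suc : ∀ n → T (suc n) ≈ const (x11 * y11 - x12 * y12) n + (W ⊛ U) n
  T-suc n = begin
    T (suc n)                                                ≡⟨ ≡.cong ∑ (List.map-∘ (forests (suc n))) ⟨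
    ∑ (map (weight ∘ node) (forests (suc n)))                ≈⟨ ∑-forests-suc (weight ∘ node) n ⟩
    byFirstTree (weight ∘ node) n 0 + ∑ (applyUpTo (byFirstTree (weight ∘ node) n ∘ suc) n)
      ≈⟨ +-cong (firstChildLeaf n) (∑-applyUpTo-cong (firstChildInterior n) n) ⟩
    (const (x11 * y11 - x12 * y12) n + W 0 * U n) + ∑ (applyUpTo (λ j → W (suc j) * U (n ∸ suc j)) n)
      ≈⟨ +-assoc _ _ _ ⟩
    const (x11 * y11 - x12 * y12) n + (W ⊛ U) n              ∎

  V≋ : V ≋ (T ⊕ const x2) ⊕ ⊝ 𝟙
  V≋ zero    = trans V-zero (sym (trans (+-congʳ (+-congʳ T-zero)) (xyx⁻¹≈y 1# x2)))
  V≋ (suc n) = trans (V-suc n) (sym (trans (+-congˡ -0#≈0#) (trans (+-identityʳ _) (+-identityʳ _))))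

  W≋ : W ≋ const (x12 * y12) ⊕ const y2 ⊛ (T ⊕ ⊝ 𝟙)
  W≋ zero    = sym (begin
    x12 * y12 + (const y2 ⊛ (T ⊕ ⊝ 𝟙)) 0 ≈⟨ +-congˡ (const-⊛ y2 (T ⊕ ⊝ 𝟙) 0) ⟩
    x12 * y12 + y2 * (T 0 - 1#)         ≈⟨ +-congˡ (*-congˡ (trans (+-congʳ T-zero) (-‿inverseʳ 1#))) ⟩
    x12 * y12 + y2 * 0#                 ≈⟨ trans (+-congˡ (zeroʳ y2)) (+-identityʳ _) ⟩
    x12 * y12                           ∎)
  W≋ (suc n) = sym (begin
    0# + (const y2 ⊛ (T ⊕ ⊝ 𝟙)) (suc n) ≈⟨ +-identityˡ _ ⟩
    (const y2 ⊛ (T ⊕ ⊝ 𝟙)) (suc n)      ≈⟨ const-⊛ y2 (T ⊕ ⊝ 𝟙) (suc n) ⟩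
    y2 * (T (suc n) - 0#)               ≈⟨ *-congˡ (trans (+-congˡ -0#≈0#) (+-identityʳ _)) ⟩
    y2 * T (suc n)                      ∎)

  U-equation : U ≋ 𝟙 ⊕ X ⊛ (((T ⊕ const x2) ⊕ ⊝ 𝟙) ⊛ U)
  U-equation = ≋-1+X⊛ U-zero (λ n → trans (U-suc n) (⊛-cong V≋ (≋-refl {U}) n))

  T-equation : T ≋ 𝟙 ⊕ X ⊛ ((const (x11 * y11) ⊕ ⊝ const (x12 * y12)) ⊕ (const (x12 * y12) ⊕ const y2 ⊛ (T ⊕ ⊝ 𝟙)) ⊛ U)
  T-equation = ≋-1+X⊛ T-zero (λ n → trans (T-suc n) (+-cong (const-difference n) (⊛-cong W≋ (≋-refl {U}) n)))
    where
    const-difference : const (x11 * y11 - x12 * y12) ≋ const (x11 * y11) ⊕ ⊝ const (x12 * y12)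
    const-difference = ≋-trans (const-+ (x11 * y11) (- (x12 * y12))) (λ n → +-congˡ (const-⊝ (x12 * y12) n))

  T-one : T 1 ≈ x11 * y11
  T-one = trans (+-identityʳ (weight (node (node [] ∷ [])))) weight-edge

  -- the series of the paper, whose conventions G₀ = y₂ and G₁ = x₁₂y₁₂ replace T₀ = 1 and T₁ = x₁₁y₁₁
  G : Series
  G zero          = y2
  G (suc zero)    = x12 * y12
  G (suc (suc n)) = T (suc (suc n))

  private
    E-P : Series
    E-P = const (x12 * y12) ⊕ ⊝ const (x11 * y11)

  G≋ : G ≋ (T ⊕ (const y2 ⊕ ⊝ 𝟙)) ⊕ X ⊛ E-P
  G≋ zero = sym (begin
    (T 0 + (y2 - 1#)) + (X ⊛ E-P) 0 ≈⟨ +-cong (+-congʳ T-zero) (X-⊛ E-P 0) ⟩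
    (1# + (y2 - 1#)) + 0#           ≈⟨ +-identityʳ _ ⟩
    1# + (y2 - 1#)                  ≈⟨ +-assoc 1# y2 (- 1#) ⟨
    (1# + y2) - 1#                  ≈⟨ xyx⁻¹≈y 1# y2 ⟩
    y2                              ∎)
  G≋ (suc zero) = sym (begin
    (T 1 + (0# - 0#)) + (X ⊛ E-P) 1
      ≈⟨ +-cong (trans (+-congˡ (-‿inverseʳ 0#)) (+-identityʳ (T 1))) (X-⊛ E-P 1) ⟩
    T 1 + (x12 * y12 - x11 * y11)
      ≈⟨ +-congʳ T-one ⟩
    x11 * y11 + (x12 * y12 - x11 * y11)
      ≈⟨ +-assoc (x11 * y11) (x12 * y12) (- (x11 * y11)) ⟨
    (x11 * y11 + x12 * y12) - x11 * y11
      ≈⟨ xyx⁻¹≈y (x11 * y11) (x12 * y12) ⟩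
    x12 * y12 ∎)
  G≋ (suc (suc n)) = sym (begin
    (T (2+ n) + (0# - 0#)) + (X ⊛ E-P) (2+ n)
      ≈⟨ +-cong (+-congˡ (-‿inverseʳ 0#)) (trans (X-⊛ E-P (2+ n)) (-‿inverseʳ 0#)) ⟩
    (T (2+ n) + 0#) + 0#
      ≈⟨ trans (+-identityʳ _) (+-identityʳ _) ⟩
    T (2+ n) ∎)
    where 2+ = λ n → suc (suc n)

open import Defs
open import Data.Product using (Σ; _×_)

polynomials : CommutativeRing 0ℓ 0ℓ
polynomials = MvPolynomial.ring 6

series : CommutativeRing 0ℓ 0ℓ
series = PowerSeries.commutativeRing polynomials

module 𝒫 = CommutativeRing polynomials
module 𝕊 = CommutativeRing series
open PowerSeries polynomials using (_≋_; _⊕_; ⊝_; _⊛_; 𝟙; X; const; ≋-sym; ≋-trans; ⊛-cong; X-⊛; const-+; const-*)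
open WeightedTrees polynomials mono MvPolynomial.monomial-+ MvPolynomial.monomial-zero
  using (T; U; T-equation; U-equation; G≋) renaming (G to Gᵀ)
module Identity = GeneratingFunctions series

module _ where
  open import Data.Integer.Solver using (module +-*-Solver)
  open +-*-Solver

  2*i≡i+i : ∀ i → + 2 ℤ.* i ≡ i ℤ.+ i
  2*i≡i+i = solve 1 (λ i → con (+ 2) :* i := i :+ i) ≡.refl

  -2*i≡-[i+i] : ∀ i → ℤ.- (+ 2) ℤ.* i ≡ ℤ.- (i ℤ.+ i)
  -2*i≡-[i+i] = solve 1 (λ i → con (ℤ.- (+ 2)) :* i := :- (i :+ i)) ≡.refl

  i-[i-j]≡j : ∀ i j → i ℤ.- (i ℤ.- j) ≡ j
  i-[i-j]≡j = solve 2 (λ i j → i :- (i :- j) := j) ≡.refl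

i+i≡j+j⇒i≡j : ∀ {i j} → i ℤ.+ i ≡ j ℤ.+ j → i ≡ j
i+i≡j+j⇒i≡j {i} {j} eq = ℤ.*-cancelˡ-≡ (+ 2) i j (≡.trans (2*i≡i+i i) (≡.trans eq (≡.sym (2*i≡i+i j))))

Σₚ≈∑ : ∀ ps → Σₚ ps 𝒫.≈ Sums.∑ 𝒫.semiring ps
Σₚ≈∑ []       α = ≡.refl
Σₚ≈∑ (p ∷ ps) α = ≡.cong (λ t → p α ℤ.+ t) (Σₚ≈∑ ps α)

*ₛ≋⊛ : ∀ f g → f *ₛ g ≋ f ⊛ g
*ₛ≋⊛ f g n α = ≡.trans (Σₚ≈∑ (map h (upTo (suc n))) α)
                       (≡.cong (λ ps → Sums.∑ 𝒫.semiring ps α) (List.map-upTo h (suc n)))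
  where
  open import Data.List using (upTo)
  h : ℕ → Poly
  h k = f k *ₚ g (n ∸ k)

+ₛ-cong : ∀ {f f′ g g′} → f ≋ f′ → g ≋ g′ → f +ₛ g ≋ f′ ⊕ g′
+ₛ-cong f≋f′ g≋g′ n α = ≡.cong₂ ℤ._+_ (f≋f′ n α) (g≋g′ n α)

-ₛ-cong : ∀ {f f′ g g′} → f ≋ f′ → g ≋ g′ → f -ₛ g ≋ f′ ⊕ ⊝ g′
-ₛ-cong f≋f′ g≋g′ n α = ≡.cong₂ ℤ._-_ (f≋f′ n α) (g≋g′ n α)

*ₛ-cong : ∀ {f f′ g g′} → f ≋ f′ → g ≋ g′ → f *ₛ g ≋ f′ ⊛ g′
*ₛ-cong {f} {g = g} f≋f′ g≋g′ = ≋-trans (*ₛ≋⊛ f g) (⊛-cong f≋f′ g≋g′)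

q≋X : q ≋ X
q≋X zero          α = ≡.refl
q≋X (suc zero)    α = MvPolynomial.monomial-zero α
q≋X (suc (suc n)) α = ≡.refl

C≋const : ∀ r → C r ≋ const r
C≋const r zero    α = ≡.refl
C≋const r (suc n) α = ≡.refl

C1ₚ≋𝟙 : C 1ₚ ≋ 𝟙
C1ₚ≋𝟙 zero      = MvPolynomial.monomial-zero
C1ₚ≋𝟙 (suc n) α = ≡.refl

const-subₚ : ∀ r r′ → const (r -ₚ r′) ≋ const r ⊕ ⊝ const r′
const-subₚ r r′ zero    α = ≡.refl
const-subₚ r r′ (suc n) α = ≡.refl

double≋2#⊛ : ∀ s → s ⊕ s ≋ Identity.2# ⊛ s
double≋2#⊛ s = 𝕊.sym (𝕊.trans (𝕊.distribʳ s 𝟙 𝟙) (𝕊.+-cong (𝕊.*-identityˡ s) (𝕊.*-identityˡ s)))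

const-2· : ∀ r → const ((+ 2) ·ₚ r) ≋ Identity.2# ⊛ const r
const-2· r = ≋-trans doubled (double≋2#⊛ (const r))
  where
  doubled : const ((+ 2) ·ₚ r) ≋ const r ⊕ const r
  doubled zero    α = 2*i≡i+i (r α)
  doubled (suc n) α = ≡.refl

const-[-2]· : ∀ r → const ((ℤ.- (+ 2)) ·ₚ r) ≋ ⊝ (Identity.2# ⊛ const r)
const-[-2]· r = ≋-trans doubled (𝕊.-‿cong (double≋2#⊛ (const r)))
  where
  doubled : const ((ℤ.- (+ 2)) ·ₚ r) ≋ ⊝ (const r ⊕ const r)
  doubled zero    α = -2*i≡-[i+i] (r α)
  doubled (suc n) α = ≡.refl

X₂ Y₂ P E : Ser
X₂ = const x2
Y₂ = const y2
P  = const (x11 *ₚ y11)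
E  = const (x12 *ₚ y12)

open Identity.Quadratic X X₂ Y₂ P E using (numerator; radicand; root; root-expansion; root²≈radicand)
  renaming (G to Gᴵ)

Num≋numerator : Num ≋ numerator
Num≋numerator = +ₛ-cong C1ₚ≋𝟙 (+ₛ-cong (*ₛ-cong a₀ q≋X) (*ₛ-cong a₁ (*ₛ-cong q≋X q≋X)))
  where
  a₀ = ≋-trans (C≋const a0) (const-subₚ y2 x2)
  a₁ = ≋-trans (C≋const a1) (const-subₚ (x12 *ₚ y12) (x11 *ₚ y11))

Rad≋radicand : Rad ≋ radicand
Rad≋radicand = +ₛ-cong C1ₚ≋𝟙 (+ₛ-cong (*ₛ-cong a₂ q≋X) (+ₛ-cong (*ₛ-cong a₃ (*ₛ-cong q≋X q≋X))
  (+ₛ-cong (*ₛ-cong a₄ (*ₛ-cong q≋X (*ₛ-cong q≋X q≋X))) (*ₛ-cong a₅ (*ₛ-cong q≋X (*ₛ-cong q≋X (*ₛ-cong q≋X q≋X)))))))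
  where
  2# = Identity.2#
  x11y11 = x11 *ₚ y11
  x12y12 = x12 *ₚ y12
  x₂+y₂ = const-+ x2 y2
  p-e   = const-subₚ x11y11 x12y12
  a₂ = ≋-trans (C≋const a2) (≋-trans (const-[-2]· (x2 +ₚ y2)) (𝕊.-‿cong (𝕊.*-congˡ {2#} x₂+y₂)))
  a₃ = ≋-trans (C≋const a3) (≋-trans (const-subₚ ((x2 +ₚ y2) *ₚ (x2 +ₚ y2)) ((+ 2) ·ₚ (x11y11 +ₚ x12y12)))
         (𝕊.+-cong (≋-trans (const-* (x2 +ₚ y2) (x2 +ₚ y2)) (𝕊.*-cong x₂+y₂ x₂+y₂))
                   (𝕊.-‿cong (≋-trans (const-2· (x11y11 +ₚ x12y12)) (𝕊.*-congˡ {2#} (const-+ x11y11 x12y12))))))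
  a₄ = ≋-trans (C≋const a4) (≋-trans (const-2· ((x11y11 -ₚ x12y12) *ₚ (x2 -ₚ y2)))
         (𝕊.*-congˡ {2#} (≋-trans (const-* (x11y11 -ₚ x12y12) (x2 -ₚ y2)) (𝕊.*-cong p-e (const-subₚ x2 y2)))))
  a₅ = ≋-trans (C≋const a5) (≋-trans (const-* (x11y11 -ₚ x12y12) (x11y11 -ₚ x12y12)) (𝕊.*-cong p-e p-e))

Gser≋Gᵀ : Gser ≋ Gᵀ
Gser≋Gᵀ zero          α = ≡.refl
Gser≋Gᵀ (suc zero)    α = ≡.refl
Gser≋Gᵀ (suc (suc n))   = Σₚ≈∑ (map weight (planeTrees (suc (suc n))))

2·1ₚ≋2# : C ((+ 2) ·ₚ 1ₚ) ≋ Identity.2#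
2·1ₚ≋2# = ≋-trans (C≋const ((+ 2) ·ₚ 1ₚ))
  (≋-trans (const-2· 1ₚ) (𝕊.trans (𝕊.*-congˡ {Identity.2#} (≋-trans (≋-sym (C≋const 1ₚ)) C1ₚ≋𝟙)) (𝕊.*-identityʳ Identity.2#)))

2qG : Ser
2qG = (C ((+ 2) ·ₚ 1ₚ) *ₛ q) *ₛ Gser

sqrtRad : Ser
sqrtRad = Num -ₛ 2qG

sqrtRad≋root : sqrtRad ≋ root T U
sqrtRad≋root = -ₛ-cong Num≋numerator (*ₛ-cong (*ₛ-cong 2·1ₚ≋2# q≋X) (≋-trans Gser≋Gᵀ G≋))

sqrtRad-constant : sqrtRad 0 𝒫.≈ 𝒫.1#
sqrtRad-constant = 𝒫.trans (sqrtRad≋root 0) (𝒫.trans (root-expansion T U 0)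
  (𝒫.trans (𝒫.+-congˡ {𝒫.1#} (X-⊛ (((Y₂ ⊕ ⊝ X₂) ⊕ (E ⊕ ⊝ P) ⊛ X) ⊕ ⊝ (Identity.2# ⊛ Gᴵ T U)) 0))
           (𝒫.+-identityʳ 𝒫.1#)))

sqrtRad-squared : sqrtRad ⊛ sqrtRad ≋ Rad
sqrtRad-squared = ≋-trans (⊛-cong sqrtRad≋root sqrtRad≋root)
  (≋-trans (root²≈radicand T U T-equation U-equation) (≋-sym Rad≋radicand))

sqrtRad-isSqrt : IsSqrt sqrtRad Rad
sqrtRad-isSqrt = (λ α → ≡.trans (sqrtRad-constant α) (≡.sym (MvPolynomial.monomial-zero α)))
               , ≋-trans (*ₛ≋⊛ sqrtRad sqrtRad) sqrtRad-squared

isSqrt-unique : ∀ R → IsSqrt R Rad → R ≋ sqrtRad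
isSqrt-unique R (R₀≡1ₚ , R²≋Rad) =
  PowerSeries.square-root-unique polynomials (λ eq α → i+i≡j+j⇒i≡j (eq α))
    (λ α → ≡.trans (R₀≡1ₚ α) (MvPolynomial.monomial-zero α)) sqrtRad-constant
    (≋-trans (≋-sym (*ₛ≋⊛ R R)) (≋-trans R²≋Rad (≋-sym sqrtRad-squared)))

theorem1p8 : Σ Ser (λ R → IsSqrt R Rad)
    × ((R : Ser) → IsSqrt R Rad → ((C ((+ 2) ·ₚ 1ₚ) *ₛ q) *ₛ Gser) ≈ₛ (Num -ₛ R))
theorem1p8 = (sqrtRad , sqrtRad-isSqrt) , λ R R-isSqrt n α → begin
  2qG n α                 ≡⟨ i-[i-j]≡j (Num n α) (2qG n α) ⟨
  Num n α ℤ.- sqrtRad n α ≡⟨ ≡.cong (λ r → Num n α ℤ.- r) (isSqrt-unique R R-isSqrt n α) ⟨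
  Num n α ℤ.- R n α       ∎
  where open ≡.≡-Reasoning
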